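{- Let $a,b$ be positive integers with $a\oplus b\oplus(a+b)=0$. Then among the three numbers $a$, $b$, $a+b$, two have the same number of binary digits and the remaining one has strictly fewer binary digits.
   Context: $\oplus$ denotes bitwise exclusive-or. -}

module Defs where

open import Data.Nat using (ℕ; zero; suc; _+_; _*_)
open import Data.Nat.DivMod using (_/_; _%_)

-- Bitwise exclusive-or on ℕ.  The first argument is fuel; with fuel ≥ max a b
-- (we use a + b) the recursion fully processes both binary expansions.
xorFuel : ℕ → ℕ → ℕ → ℕ
xorFuel zero    a b = 0
xorFuel (suc k) a b = bit (a % 2) (b % 2) + 2 * xorFuel k (a / 2) (b / 2)
  where
  bit : ℕ → ℕ → ℕ
  bit zero    zero    = 0
  bit zero    (suc _) = 1
  bit (suc _) zero    = 1
  bit (suc _) (suc _) = 0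

_⊕_ : ℕ → ℕ → ℕ
a ⊕ b = xorFuel (a + b) a b

infixl 6 _⊕_

-- Number of binary digits of n (binLength 0 = 0, binLength n = ⌊log₂ n⌋ + 1 for n > 0).
lenFuel : ℕ → ℕ → ℕ
lenFuel zero    n       = 0
lenFuel (suc k) zero    = 0
lenFuel (suc k) (suc m) = suc (lenFuel k (suc m / 2))

binLength : ℕ → ℕ
binLength n = lenFuel n n

-- Since x ⊕ y = 0 forces x = y, the hypothesis says a ⊕ b = a + b: adding a and b
-- produces no carry, i.e. no binary digit is set in both.  Peeling off the last
-- digit and inducting, a carry-free pair other than (0, 0) consists of numbers of
-- different lengths, and its sum is as long as the longer one: the two leading
-- digits cannot coincide, and below the leading digit of the longer number the
-- sum stays carry-free.
module Submission where

open import Defs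
open import Data.Nat using (ℕ; zero; suc; _+_; _*_; _<_; _≤_; z≤n; s≤s; _/_; _%_)
open import Data.Nat.Properties
open import Data.Nat.DivMod using ([m+kn]%n≡m%n; m*n/n≡m; m/n<m; +-distrib-/-∣ʳ)
open import Data.Nat.Divisibility using (divides-refl)
open import Data.Nat.Tactic.RingSolver using (solve-∀)
open import Data.Product using (_×_; _,_)
open import Data.Sum using (_⊎_; inj₁; inj₂)
open import Data.Empty using (⊥-elim)
open import Function using (_∘_)
open import Relation.Binary.PropositionalEquality
  using (_≡_; refl; sym; trans; cong; cong₂; subst; module ≡-Reasoning)

data IsBit : ℕ → Set where
  bit0 : IsBit 0
  bit1 : IsBit 1

data Halving : ℕ → Set where
  halving : ∀ {x} → IsBit x → (m : ℕ) → Halving (x + m * 2)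

halve : ∀ n → Halving n
halve zero = halving bit0 0
halve (suc zero) = halving bit1 0
halve (suc (suc n)) with halve n
... | halving bit0 m = halving bit0 (suc m)
... | halving bit1 m = halving bit1 (suc m)

bit+double%2≡bit : ∀ {x} → IsBit x → ∀ m → (x + m * 2) % 2 ≡ x
bit+double%2≡bit bit0 m = [m+kn]%n≡m%n 0 m 2
bit+double%2≡bit bit1 m = [m+kn]%n≡m%n 1 m 2

bit+double/2≡half : ∀ {x} → IsBit x → ∀ m → (x + m * 2) / 2 ≡ m
bit+double/2≡half bit0 m = trans (+-distrib-/-∣ʳ 0 {m * 2} {2} (divides-refl m)) (m*n/n≡m m 2)
bit+double/2≡half bit1 m = trans (+-distrib-/-∣ʳ 1 {m * 2} {2} (divides-refl m)) (m*n/n≡m m 2)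

+-halvings : ∀ x m y n → (x + m * 2) + (y + n * 2) ≡ (x + y) + (m + n) * 2
+-halvings = solve-∀

m*2≤1+n⇒m≤n : ∀ m n → m * 2 ≤ suc n → m ≤ n
m*2≤1+n⇒m≤n zero n _ = z≤n
m*2≤1+n⇒m≤n (suc m) (suc n) (s≤s le) = s≤s (m*2≤1+n⇒m≤n m n (≤-trans (n≤1+n (m * 2)) le))

[1+n]/2≤n : ∀ n → suc n / 2 ≤ n
[1+n]/2≤n n = ≤-pred (m/n<m (suc n) 2 (s≤s (s≤s z≤n)))

lenFuel-irrelevant : ∀ j k n → n ≤ j → n ≤ k → lenFuel j n ≡ lenFuel k n
lenFuel-irrelevant zero zero zero _ _ = refl
lenFuel-irrelevant zero (suc k) zero _ _ = refl
lenFuel-irrelevant (suc j) zero zero _ _ = refl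
lenFuel-irrelevant (suc j) (suc k) zero _ _ = refl
lenFuel-irrelevant (suc j) (suc k) (suc n) (s≤s n≤j) (s≤s n≤k) =
  cong suc (lenFuel-irrelevant j k (suc n / 2) (≤-trans ([1+n]/2≤n n) n≤j) (≤-trans ([1+n]/2≤n n) n≤k))

binLength-pos : ∀ {n} → 0 < n → binLength n ≡ suc (binLength (n / 2))
binLength-pos {suc n} _ =
  cong suc (lenFuel-irrelevant n (suc n / 2) (suc n / 2) ([1+n]/2≤n n) ≤-refl)

0<binLength⇒0< : ∀ {n} → 0 < binLength n → 0 < n
0<binLength⇒0< {suc n} _ = s≤s z≤n

0<bit+double : ∀ x {m} → 0 < m → 0 < x + m * 2
0<bit+double x {suc m} _ = ≤-trans (s≤s z≤n) (m≤n+m (suc m * 2) x)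

binLength-halving : ∀ {x} m → IsBit x → 0 < x + m * 2 → binLength (x + m * 2) ≡ suc (binLength m)
binLength-halving m b pos = trans (binLength-pos pos) (cong (suc ∘ binLength) (bit+double/2≡half b m))

binLength-halving-≤ : ∀ {x} m → IsBit x → binLength (x + m * 2) ≤ suc (binLength m)
binLength-halving-≤ zero bit0 = z≤n
binLength-halving-≤ zero bit1 = ≤-refl
binLength-halving-≤ {x} (suc m) b = ≤-reflexive (binLength-halving (suc m) b (0<bit+double x {suc m} (s≤s z≤n)))

-- The digit function of xorFuel, which Defs keeps local.
xorBit : ℕ → ℕ → ℕ
xorBit zero    zero    = 0
xorBit zero    (suc _) = 1
xorBit (suc _) zero    = 1
xorBit (suc _) (suc _) = 0

xorFuel-suc : ∀ k a b → xorFuel (suc k) a b ≡ xorBit (a % 2) (b % 2) + 2 * xorFuel k (a / 2) (b / 2)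
xorFuel-suc k a b with a % 2 | b % 2
... | zero  | zero  = refl
... | zero  | suc _ = refl
... | suc _ | zero  = refl
... | suc _ | suc _ = refl

xorFuel-halving : ∀ k {x y} m n → IsBit x → IsBit y →
                  xorFuel (suc k) (x + m * 2) (y + n * 2) ≡ xorBit x y + xorFuel k m n * 2
xorFuel-halving k {x} {y} m n bx by = begin
  xorFuel (suc k) (x + m * 2) (y + n * 2)
    ≡⟨ xorFuel-suc k (x + m * 2) (y + n * 2) ⟩
  xorBit ((x + m * 2) % 2) ((y + n * 2) % 2) + 2 * xorFuel k ((x + m * 2) / 2) ((y + n * 2) / 2)
    ≡⟨ cong₂ (λ u v → xorBit u v + 2 * xorFuel k ((x + m * 2) / 2) ((y + n * 2) / 2))
             (bit+double%2≡bit bx m) (bit+double%2≡bit by n) ⟩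
  xorBit x y + 2 * xorFuel k ((x + m * 2) / 2) ((y + n * 2) / 2)
    ≡⟨ cong₂ (λ u v → xorBit x y + 2 * xorFuel k u v) (bit+double/2≡half bx m) (bit+double/2≡half by n) ⟩
  xorBit x y + 2 * xorFuel k m n
    ≡⟨ cong (xorBit x y +_) (*-comm 2 (xorFuel k m n)) ⟩
  xorBit x y + xorFuel k m n * 2 ∎
  where open ≡-Reasoning

xorBit≤+ : ∀ x y → xorBit x y ≤ x + y
xorBit≤+ zero    zero    = z≤n
xorBit≤+ zero    (suc y) = s≤s z≤n
xorBit≤+ (suc x) zero    = s≤s z≤n
xorBit≤+ (suc x) (suc y) = z≤n

xorFuel≤+ : ∀ k a b → xorFuel k a b ≤ a + b
xorFuel≤+ zero a b = z≤n
xorFuel≤+ (suc k) a b with halve a | halve b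
... | halving {x} bx m | halving {y} by n = begin
  xorFuel (suc k) (x + m * 2) (y + n * 2) ≡⟨ xorFuel-halving k m n bx by ⟩
  xorBit x y + xorFuel k m n * 2          ≤⟨ +-mono-≤ (xorBit≤+ x y) (*-monoˡ-≤ 2 (xorFuel≤+ k m n)) ⟩
  (x + y) + (m + n) * 2                   ≡⟨ sym (+-halvings x m y n) ⟩
  (x + m * 2) + (y + n * 2)               ∎
  where open ≤-Reasoning

xorBit≡0⇒≡ : ∀ {x y} → IsBit x → IsBit y → xorBit x y ≡ 0 → x ≡ y
xorBit≡0⇒≡ bit0 bit0 _ = refl
xorBit≡0⇒≡ bit1 bit1 _ = refl

xorFuel≡0⇒≡ : ∀ k {a b} → a + b ≤ k → xorFuel k a b ≡ 0 → a ≡ b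
xorFuel≡0⇒≡ zero {a} {b} a+b≤0 _ = trans (m+n≡0⇒m≡0 a a+b≡0) (sym (m+n≡0⇒n≡0 a a+b≡0))
  where
  a+b≡0 : a + b ≡ 0
  a+b≡0 = n≤0⇒n≡0 a+b≤0
xorFuel≡0⇒≡ (suc k) {a} {b} a+b≤1+k eq with halve a | halve b
... | halving {x} bx m | halving {y} by n = cong₂ (λ u v → u + v * 2) x≡y m≡n
  where
  xor≡0 : xorBit x y + xorFuel k m n * 2 ≡ 0
  xor≡0 = trans (sym (xorFuel-halving k m n bx by)) eq
  x≡y : x ≡ y
  x≡y = xorBit≡0⇒≡ bx by (m+n≡0⇒m≡0 _ xor≡0)
  m+n≤k : m + n ≤ k
  m+n≤k = m*2≤1+n⇒m≤n (m + n) k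
    (≤-trans (m≤n+m _ (x + y)) (≤-trans (≤-reflexive (sym (+-halvings x m y n))) a+b≤1+k))
  m≡n : m ≡ n
  m≡n = xorFuel≡0⇒≡ k m+n≤k (m*n≡0⇒m≡0 _ 2 (m+n≡0⇒n≡0 (xorBit x y) xor≡0))

⊕≡0⇒≡ : ∀ {a b} → a ⊕ b ≡ 0 → a ≡ b
⊕≡0⇒≡ = xorFuel≡0⇒≡ _ ≤-refl

carryFree-halving : ∀ {x y X} m n → IsBit x → IsBit y → X ≤ m + n →
                    xorBit x y + X * 2 ≡ (x + y) + (m + n) * 2 → IsBit (x + y) × X ≡ m + n
carryFree-halving {X = X} m n bit0 bit0 _ eq = bit0 , *-cancelʳ-≡ X (m + n) 2 eq
carryFree-halving {X = X} m n bit0 bit1 _ eq = bit1 , *-cancelʳ-≡ X (m + n) 2 (suc-injective eq)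
carryFree-halving {X = X} m n bit1 bit0 _ eq = bit1 , *-cancelʳ-≡ X (m + n) 2 (suc-injective eq)
carryFree-halving {X = X} m n bit1 bit1 X≤m+n eq =
  ⊥-elim (n≮n (m + n) (subst (_≤ m + n) (*-cancelʳ-≡ X (suc (m + n)) 2 eq) X≤m+n))

Dominates : ℕ → ℕ → Set
Dominates a b = binLength b < binLength a × binLength (a + b) ≡ binLength a

OneDominates : ℕ → ℕ → Set
OneDominates a b = (a ≡ 0 × b ≡ 0) ⊎ Dominates a b ⊎ Dominates b a

dominates-halving : ∀ {x y} m n → IsBit x → IsBit y → IsBit (x + y) →
                    Dominates m n → Dominates (x + m * 2) (y + n * 2)
dominates-halving {x} {y} m n bx by bx+y (n<m , m+n~m) = shorter , sum~
  where
  0<m : 0 < m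
  0<m = 0<binLength⇒0< (≤-trans (s≤s z≤n) n<m)
  len-x+m*2 : binLength (x + m * 2) ≡ suc (binLength m)
  len-x+m*2 = binLength-halving m bx (0<bit+double x 0<m)
  shorter : binLength (y + n * 2) < binLength (x + m * 2)
  shorter = begin-strict
    binLength (y + n * 2) ≤⟨ binLength-halving-≤ n by ⟩
    suc (binLength n)     <⟨ s≤s n<m ⟩
    suc (binLength m)     ≡⟨ sym len-x+m*2 ⟩
    binLength (x + m * 2) ∎
    where open ≤-Reasoning
  sum~ : binLength ((x + m * 2) + (y + n * 2)) ≡ binLength (x + m * 2)
  sum~ = begin
    binLength ((x + m * 2) + (y + n * 2)) ≡⟨ cong binLength (+-halvings x m y n) ⟩
    binLength ((x + y) + (m + n) * 2)     ≡⟨ binLength-halving (m + n) bx+y (0<bit+double (x + y) (≤-trans 0<m (m≤m+n m n))) ⟩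
    suc (binLength (m + n))               ≡⟨ cong suc m+n~m ⟩
    suc (binLength m)                     ≡⟨ sym len-x+m*2 ⟩
    binLength (x + m * 2)                 ∎
    where open ≡-Reasoning

oneDominates-halving : ∀ {x y} m n → IsBit x → IsBit y → IsBit (x + y) →
                       OneDominates m n → OneDominates (x + m * 2) (y + n * 2)
oneDominates-halving .0 .0 bit0 bit0 _ (inj₁ (refl , refl)) = inj₁ (refl , refl)
oneDominates-halving .0 .0 bit0 bit1 _ (inj₁ (refl , refl)) = inj₂ (inj₂ (s≤s z≤n , refl))
oneDominates-halving .0 .0 bit1 bit0 _ (inj₁ (refl , refl)) = inj₂ (inj₁ (s≤s z≤n , refl))
oneDominates-halving .0 .0 bit1 bit1 () (inj₁ (refl , refl))
oneDominates-halving m n bx by bx+y (inj₂ (inj₁ m≻n)) = inj₂ (inj₁ (dominates-halving m n bx by bx+y m≻n))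
oneDominates-halving {x} {y} m n bx by bx+y (inj₂ (inj₂ n≻m)) =
  inj₂ (inj₂ (dominates-halving n m by bx (subst IsBit (+-comm x y) bx+y) n≻m))

carryFree⇒oneDominates : ∀ k {a b} → xorFuel k a b ≡ a + b → OneDominates a b
carryFree⇒oneDominates zero {a} eq = inj₁ (m+n≡0⇒m≡0 a (sym eq) , m+n≡0⇒n≡0 a (sym eq))
carryFree⇒oneDominates (suc k) {a} {b} eq with halve a | halve b
... | halving {x} bx m | halving {y} by n
  with carryFree-halving m n bx by (xorFuel≤+ k m n)
         (trans (sym (xorFuel-halving k m n bx by)) (trans eq (+-halvings x m y n)))
...   | bx+y , carryFree = oneDominates-halving m n bx by bx+y (carryFree⇒oneDominates k carryFree)

lemma7p8 : (a b : ℕ) → 0 < a → 0 < b → (a ⊕ b) ⊕ (a + b) ≡ 0 →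
    (binLength a ≡ binLength b × binLength (a + b) < binLength a)
    ⊎ (binLength a ≡ binLength (a + b) × binLength b < binLength a)
    ⊎ (binLength b ≡ binLength (a + b) × binLength a < binLength b)
lemma7p8 a b 0<a _ h with carryFree⇒oneDominates (a + b) (⊕≡0⇒≡ h)
... | inj₁ (refl , _) = ⊥-elim (n≮n 0 0<a)
... | inj₂ (inj₁ (b<a , a+b~a)) = inj₂ (inj₁ (sym a+b~a , b<a))
... | inj₂ (inj₂ (a<b , b+a~b)) = inj₂ (inj₂ (sym (trans (cong binLength (+-comm a b)) b+a~b) , a<b))
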